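{- Let $G\in\mathcal{G}(\widehat{C}_6,\widehat{C}_7)$, let $x\in V(G)$, let $A$ be a connected component of $H_x[N_2(x)]$, and let $a,b$ be two adjacent vertices of $A$. If $|N(a)\cap N(x)|=|N(b)\cap N(x)|=2$, then there is no independent set $S\subseteq N_2(x)$ of $H_x$ which dominates $N(x)$.
   Context: Graphs are finite, simple, undirected. $\mathcal{G}(\widehat{C}_6,\widehat{C}_7)$ is the class of graphs containing no (not necessarily induced) subgraph isomorphic to $C_6$ or $C_7$. For a nonempty vertex set $S$, $N(S)$ (resp. $N[S]$) is the set of vertices at distance exactly $1$ (resp. at most $1$) from $S$; $N_2(x)$ (resp. $N_2[x]$) the set at distance exactly $2$ (resp. at most $2$) from $x$; $N[\emptyset]=\emptyset$. A set $S$ dominates $T$ if $T\subseteq N[S]$. Construction of $H_x$ (neighborhoods in $G$): let $A^*$ be the set of all connected components $A_0$ of $G[N_2(x)]$ for which some $a_0\in V(A_0)$ satisfies $N(x)\cap N(a_0)=N(x)\cap N(V(A_0))$, let $V(A^*)$ be the union of their vertex sets, and $H_x=G[N_2[x]\setminus N[V(A^*)]]$. In the claim itself, all neighborhoods $N(\cdot)$, $N[\cdot]$ and $N_2(x)$ are taken in the graph $H_x$. -}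

module Defs where

open import Data.Nat using (ℕ; zero; suc)
open import Data.Fin using (Fin; zero; suc; inject₁; fromℕ)
open import Data.Fin.Subset using (Subset; _∈_; _∉_)
open import Data.Bool using (Bool; true; false; T)
open import Data.Product using (Σ; _×_; _,_; ∃)
open import Data.Sum using (_⊎_)
open import Data.Empty using (⊥)
open import Data.Unit using (⊤)
open import Relation.Nullary using (¬_)
open import Relation.Binary.PropositionalEquality using (_≡_; _≢_)
open import Function.Definitions using (Injective)

record Graph : Set where
  field
    n          : ℕ
    adj        : Fin n → Fin n → Bool
    adj-sym    : ∀ u v → adj u v ≡ adj v u
    adj-irrefl : ∀ v → adj v v ≡ false

module _ (G : Graph) where
  open Graph G

  V : Set
  V = Fin n

  E : V → V → Set
  E u v = T (adj u v)

  -- G contains a (not necessarily induced) subgraph isomorphic to C_k: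
  -- an injective map f : Fin k → V with f i ~ f (i+1) cyclically.
  ContainsC : ℕ → Set
  ContainsC zero = ⊥
  ContainsC (suc m) =
    Σ (Fin (suc m) → V) λ f →
      Injective _≡_ _≡_ f
      × (∀ (i : Fin m) → E (f (inject₁ i)) (f (suc i)))
      × E (f (fromℕ m)) (f zero)

  C6C7Free : Set
  C6C7Free = ¬ ContainsC 6 × ¬ ContainsC 7

  data Walk (S : V → Set) : V → V → Set where
    here : ∀ {u} → S u → Walk S u u
    step : ∀ {u w v} → S u → E u w → Walk S w v → Walk S u v

  Component : (S : V → Set) → Subset n → Set
  Component S C =
    (∀ v → v ∈ C → S v)
    × (∃ λ v → v ∈ C)
    × (∀ u v → u ∈ C → v ∈ C → Walk S u v)
    × (∀ u v → u ∈ C → S v → E u v → v ∈ C)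

  Nb : (W : V → Set) → V → V → Set
  Nb W v u = W u × E v u

  NbSet : (W : V → Set) → (V → Set) → V → Set
  NbSet W S u = W u × ¬ S u × Σ V λ s → S s × E s u

  ClNbSet : (W : V → Set) → (V → Set) → V → Set
  ClNbSet W S u = W u × (S u ⊎ Σ V λ s → S s × E s u)

  N₂ : (W : V → Set) → V → V → Set
  N₂ W x u = W u × u ≢ x × ¬ E x u × Σ V λ w → W w × E x w × E w u

  N₂cl : (W : V → Set) → V → V → Set
  N₂cl W x u = W u × (u ≡ x ⊎ E x u ⊎ N₂ W x u)

  All : V → Set
  All _ = ⊤

  SameSet : (V → Set) → (V → Set) → Set
  SameSet P Q = (∀ u → P u → Q u) × (∀ u → Q u → P u)

  -- Components A₀ of G[N₂(x)] put into A*: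
  -- some a₀ ∈ A₀ with N(x) ∩ N(a₀) = N(x) ∩ N(V(A₀))  (all in G)
  GoodComp : V → Subset n → Set
  GoodComp x A₀ =
    Component (N₂ All x) A₀
    × Σ V λ a₀ → a₀ ∈ A₀
        × SameSet (λ y → Nb All x y × Nb All a₀ y)
                  (λ y → Nb All x y × NbSet All (λ z → z ∈ A₀) y)

  InA* : V → V → Set
  InA* x v = Σ (Subset n) λ A₀ → GoodComp x A₀ × v ∈ A₀

  -- vertex set of H_x = G[N₂[x] ∖ N[V(A*)]]
  Hx : V → V → Set
  Hx x u = N₂cl All x u × ¬ ClNbSet All (InA* x) u

  HasSize : (V → Set) → ℕ → Set
  HasSize P k =
    Σ (Fin k → V) λ f →
      Injective _≡_ _≡_ f × (∀ i → P (f i)) × (∀ u → P u → ∃ λ i → f i ≡ u)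

  Independent : (W : V → Set) → Subset n → Set
  Independent W S = (∀ u → u ∈ S → W u) × (∀ u v → u ∈ S → v ∈ S → ¬ E u v)

  Dominates : (W : V → Set) → Subset n → (V → Set) → Set
  Dominates W S T = ∀ u → T u → ClNbSet W (λ s → s ∈ S) u

module Submission where

-- Key fact (escape): a vertex s ∈ N₂(x) outside A* has an N₂-neighbour d adjacent to an
-- x-neighbour that s misses; otherwise the N₂-component of s, with a₀ = s, would belong to
-- A*.  Each escape, placed next to a, b and their x-neighbours, closes a C₆ or C₇ unless it
-- takes a forced route (escapeRoute).  The sets {y₁,y₂} = N(a) ∩ N(x) and
-- {y₃,y₄} = N(b) ∩ N(x) either coincide, share exactly one vertex, or are disjoint.  In the
-- first case the escapes of a and b alone give a C₆.  In the other two, one of a, b — say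
-- b — is not in S, and the vertices of S dominating b's private x-neighbours escape into a
-- forbidden cycle.

open import Defs
open import Data.Nat using (ℕ; zero; suc; _≤_; _+_)
open import Data.Nat.Properties using (≤-trans; +-suc; +-monoʳ-≤; m≤m+n; <⇒≱)
open import Data.Fin using (Fin; zero; suc; inject₁; fromℕ)
open import Data.Fin.Properties using (_≟_; any?; 0≢1+n)
open import Data.Fin.Subset using (Subset; _∈_; _∉_; _⊆_; _⊂_; ∣_∣; ⁅_⁆)
open import Data.Fin.Subset.Properties
  using (_∈?_; _⊂?_; ⊆-refl; ⊆-trans; ∣p∣≤n; p⊂q⇒∣p∣<∣q∣; x∈⁅x⁆; x∈⁅y⁆⇒x≡y)
open import Data.Vec using (Vec; []; _∷_; lookup; tabulate; map)
open import Data.Vec.Properties using (lookup∘tabulate; []=⇒lookup; lookup⇒[]=)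
open import Data.Vec.Relation.Unary.All using ([]; _∷_)
open import Data.Vec.Relation.Unary.AllPairs as AllPairs using (AllPairs; []; _∷_)
open import Data.Vec.Relation.Unary.AllPairs.Properties using (map⁺)
open import Data.Vec.Relation.Unary.Unique.Propositional using (Unique)
open import Data.Vec.Relation.Unary.Unique.Propositional.Properties using (lookup-injective)
open import Data.Bool using (T)
open import Data.Bool.Properties using (T?)
open import Data.Product using (Σ; _×_; _,_; proj₁; proj₂)
open import Data.Sum using (_⊎_; inj₁; inj₂; [_,_]′)
import Data.Sum as Sum
open import Data.Empty using (⊥; ⊥-elim)
open import Data.Unit using (⊤; tt)
open import Function using (_∘_)
open import Relation.Nullary using (¬_; Dec; yes; no; does)
open import Relation.Nullary.Decidable using (dec-true; decidable-stable; _×-dec_; _⊎-dec_; ¬?)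
open import Relation.Unary using (Decidable)
open import Relation.Binary.PropositionalEquality using (_≡_; _≢_; refl; sym; trans; subst; ≢-sym)

separates : ∀ {A : Set} (P : A → Set) {u v} → P u → ¬ P v → u ≢ v
separates P Pu ¬Pv refl = ¬Pv Pu

module _ {n : ℕ} {P : Fin n → Set} (P? : Decidable P) where

  ⟦_⟧ : Subset n
  ⟦_⟧ = tabulate (λ v → does (P? v))

  ∈⟦⟧⁺ : ∀ {v} → P v → v ∈ ⟦_⟧
  ∈⟦⟧⁺ {v} Pv = lookup⇒[]= v ⟦_⟧ (trans (lookup∘tabulate _ v) (dec-true (P? v) Pv))

  ∈⟦⟧⁻ : ∀ {v} → v ∈ ⟦_⟧ → P v
  ∈⟦⟧⁻ {v} v∈ with P? v | trans (sym (lookup∘tabulate (λ w → does (P? w)) v)) ([]=⇒lookup v∈)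
  ... | yes Pv | _ = Pv
  ... | no _   | ()

-- Each
-- non-final round strictly enlarges the subset, so n rounds suffice.
module _ {n : ℕ} (f : Subset n → Subset n) (inflationary : ∀ p → p ⊆ f p)
         (I : Subset n → Set) (preserved : ∀ p → I p → I (f p)) where

  private
    stableUnlessGrowing : ∀ p → ¬ (p ⊂ f p) → f p ⊆ p
    stableUnlessGrowing p p⊄fp {v} v∈fp =
      decidable-stable (v ∈? p) (λ v∉p → p⊄fp (inflationary p , v , v∈fp , v∉p))

    -- The fuel m bounds the number of remaining growth rounds.
    closureWithin : ∀ m p → n ≤ m + ∣ p ∣ → I p → Σ (Subset n) λ q → I q × p ⊆ q × f q ⊆ q
    closureWithin m p bound Ip with p ⊂? f p
    closureWithin m p bound Ip | no p⊄fp = p , Ip , ⊆-refl , stableUnlessGrowing p p⊄fp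
    closureWithin zero p bound Ip | yes p⊂fp =
      ⊥-elim (<⇒≱ (p⊂q⇒∣p∣<∣q∣ p⊂fp) (≤-trans (∣p∣≤n (f p)) bound))
    closureWithin (suc m) p bound Ip | yes p⊂fp
      with closureWithin m (f p) (≤-trans bound fuelDecreases) (preserved p Ip)
      where
        fuelDecreases : suc m + ∣ p ∣ ≤ m + ∣ f p ∣
        fuelDecreases = subst (_≤ m + ∣ f p ∣) (+-suc m ∣ p ∣) (+-monoʳ-≤ m (p⊂q⇒∣p∣<∣q∣ p⊂fp))
    ... | q , Iq , fp⊆q , fq⊆q = q , Iq , ⊆-trans (inflationary p) fp⊆q , fq⊆q

  closure : ∀ p → I p → Σ (Subset n) λ q → I q × p ⊆ q × f q ⊆ q
  closure p = closureWithin n p (m≤m+n n ∣ p ∣)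

module _ (G : Graph) where
  open Graph G using (n; adj; adj-sym; adj-irrefl)

  E-sym : ∀ {u v} → E G u v → E G v u
  E-sym {u} {v} = subst T (adj-sym u v)

  E? : ∀ u v → Dec (E G u v)
  E? u v = T? (adj u v)

  E⇒≢ : ∀ {u v} → E G u v → u ≢ v
  E⇒≢ {u} uv refl = subst T (adj-irrefl u) uv

  walkHead : ∀ {S u v} → Walk G S u v → S u
  walkHead (here Su)     = Su
  walkHead (step Su _ _) = Su

  _++ᵂ_ : ∀ {S u w v} → Walk G S u w → Walk G S w v → Walk G S u v
  here _       ++ᵂ q = q
  step Su uw p ++ᵂ q = step Su uw (p ++ᵂ q)

  reverseᵂ : ∀ {S u v} → Walk G S u v → Walk G S v u
  reverseᵂ (here Su)       = here Su
  reverseᵂ (step Su uw p) = reverseᵂ p ++ᵂ step (walkHead p) (E-sym uw) (here Su)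

  -- Every vertex s of G[P], P decidable, lies in a connected component of G[P]: the
  -- closure of {s} under adding P-neighbours, on which "has a walk to s" is invariant.
  componentOf : (P : V G → Set) → Decidable P → ∀ s → P s →
                Σ (Subset n) λ C → Component G P C × s ∈ C
  componentOf P P? s Ps = C , (inP , (s , s∈C) , connected , closed) , s∈C
    where
      Reaching : Subset n → Set
      Reaching R = ∀ v → v ∈ R → Walk G P v s

      Joins : Subset n → V G → Set
      Joins R v = v ∈ R ⊎ (P v × Σ (V G) λ u → u ∈ R × E G u v)

      joins? : ∀ R → Decidable (Joins R)
      joins? R v = v ∈? R ⊎-dec (P? v ×-dec any? (λ u → u ∈? R ×-dec E? u v))

      grow : Subset n → Subset n
      grow R = ⟦ joins? R ⟧

      grow-inflationary : ∀ R → R ⊆ grow R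
      grow-inflationary R v∈R = ∈⟦⟧⁺ (joins? R) (inj₁ v∈R)

      grow-reaching : ∀ R → Reaching R → Reaching (grow R)
      grow-reaching R reach v v∈ with ∈⟦⟧⁻ (joins? R) v∈
      ... | inj₁ v∈R                 = reach v v∈R
      ... | inj₂ (Pv , u , u∈R , uv) = step Pv (E-sym uv) (reach u u∈R)

      seed-reaching : Reaching ⁅ s ⁆
      seed-reaching v v∈ with x∈⁅y⁆⇒x≡y s v∈
      ... | refl = here Ps

      fixpoint : Σ (Subset n) λ q → Reaching q × ⁅ s ⁆ ⊆ q × grow q ⊆ q
      fixpoint = closure grow grow-inflationary Reaching grow-reaching ⁅ s ⁆ seed-reaching

      C : Subset n
      C = proj₁ fixpoint

      reaching : Reaching C
      reaching = proj₁ (proj₂ fixpoint)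

      s∈C : s ∈ C
      s∈C = proj₁ (proj₂ (proj₂ fixpoint)) (x∈⁅x⁆ s)

      inP : ∀ v → v ∈ C → P v
      inP v v∈C = walkHead (reaching v v∈C)

      connected : ∀ u v → u ∈ C → v ∈ C → Walk G P u v
      connected u v u∈C v∈C = reaching u u∈C ++ᵂ reverseᵂ (reaching v v∈C)

      closed : ∀ u v → u ∈ C → P v → E G u v → v ∈ C
      closed u v u∈C Pv uv = proj₂ (proj₂ (proj₂ fixpoint)) (∈⟦⟧⁺ (joins? C) (inj₂ (Pv , u , u∈C , uv)))

  Path : ∀ {m} → V G → Vec (V G) m → V G → Set
  Path u []       w = E G u w
  Path u (v ∷ vs) w = E G u v × Path v vs w

  Closed : ∀ {m} → Vec (V G) (suc m) → Set
  Closed (v ∷ vs) = Path v vs v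

  path-step : ∀ {m u w} (vs : Vec (V G) m) → Path u vs w →
              ∀ i → E G (lookup (u ∷ vs) (inject₁ i)) (lookup (u ∷ vs) (suc i))
  path-step (v ∷ vs) (uv , _)    zero    = uv
  path-step (v ∷ vs) (_ , rest) (suc i) = path-step vs rest i

  path-end : ∀ {m u w} (vs : Vec (V G) m) → Path u vs w → E G (lookup (u ∷ vs) (fromℕ m)) w
  path-end []       uw         = uw
  path-end (v ∷ vs) (_ , rest) = path-end vs rest

  closed⇒ContainsC : ∀ {m} (vs : Vec (V G) (suc m)) → Unique vs → Closed vs → ContainsC G (suc m)
  closed⇒ContainsC (v ∷ vs) distinct path =
    lookup (v ∷ vs) , lookup-injective distinct _ _ , path-step vs path , path-end vs path

  record Pair (P : V G → Set) : Set where
    constructor pair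
    field
      first second : V G
      first≢second : first ≢ second
      P-first      : P first
      P-second     : P second
      only         : ∀ {y} → P y → y ≡ first ⊎ y ≡ second

  pairOf : ∀ {P} → HasSize G P 2 → Pair P
  pairOf {P} (f , f-inj , P-f , onto) =
    pair (f zero) (f (suc zero)) (λ eq → 0≢1+n (f-inj eq)) (P-f zero) (P-f (suc zero)) only
    where
      only : ∀ {y} → P y → y ≡ f zero ⊎ y ≡ f (suc zero)
      only {y} Py with onto y Py
      ... | zero     , refl = inj₁ refl
      ... | suc zero , refl = inj₂ refl

  module _ {P : V G → Set} (pr : Pair P) where
    open Pair pr

    member? : Decidable P
    member? y with y ≟ first | y ≟ second
    ... | yes refl | _        = yes P-first
    ... | no _     | yes refl = yes P-second
    ... | no y≢₁   | no y≢₂   = no (λ Py → [ y≢₁ , y≢₂ ]′ (only Py))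

    other : ∀ y → Σ (V G) λ q → P q × q ≢ y
    other y with first ≟ y
    ... | no  first≢y = first , P-first , first≢y
    ... | yes refl    = second , P-second , ≢-sym first≢second

  data Overlap (P Q : V G → Set) : Set where
    both : ∀ {y₁ y₂} → y₁ ≢ y₂ → P y₁ → P y₂ → Q y₁ → Q y₂ → Overlap P Q
    one  : ∀ {z p q} → P z → Q z → P p → ¬ Q p → Q q → ¬ P q → Overlap P Q
    none : ∀ {p q₁ q₂} → P p → q₁ ≢ q₂ → Q q₁ → Q q₂ → (∀ {y} → Q y → ¬ P y) → Overlap P Q

  module _ {P Q : V G → Set} (pP : Pair P) (pQ : Pair Q) where
    open Pair pP

    private
      oneVia : ∀ {z p} → (∀ {y} → P y → y ≡ z ⊎ y ≡ p) → P z → Q z → P p → ¬ Q p → Overlap P Q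
      oneVia {z} onlyZP Pz Qz Pp ¬Qp with other pQ z
      ... | q , Qq , q≢z = one Pz Qz Pp ¬Qp Qq (λ Pq → [ q≢z , (λ { refl → ¬Qp Qq }) ]′ (onlyZP Pq))

    overlapOf : Overlap P Q
    overlapOf with member? pQ first | member? pQ second
    ... | yes Q₁ | yes Q₂ = both first≢second P-first P-second Q₁ Q₂
    ... | yes Q₁ | no ¬Q₂ = oneVia only P-first Q₁ P-second ¬Q₂
    ... | no ¬Q₁ | yes Q₂ = oneVia (Sum.swap ∘ only) P-second Q₂ P-first ¬Q₁
    ... | no ¬Q₁ | no ¬Q₂ =
      none P-first (Pair.first≢second pQ) (Pair.P-first pQ) (Pair.P-second pQ)
        (λ Qy Py → [ (λ { refl → ¬Q₁ Qy }) , (λ { refl → ¬Q₂ Qy }) ]′ (only Py))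

-- The local structure around a fixed vertex x of a {C₆,C₇}-free graph G.  Here Inner and
-- Outer are the first and second neighbourhoods of x in G itself.
module Around (G : Graph) (free : C6C7Free G) (x : V G) where

  Outer : V G → Set
  Outer = N₂ G (All G) x

  Outer? : Decidable Outer
  Outer? u = yes tt ×-dec ¬? (u ≟ x) ×-dec ¬? (E? G x u) ×-dec any? (λ w → yes tt ×-dec E? G x w ×-dec E? G w u)

  Inner : V G → Set
  Inner = E G x

  -- Vertices in different layers are
  -- automatically distinct, so a cycle written with tagged vertices only needs the
  -- distinctness of vertices in the same layer (Apart).
  data Placed : Set where
    centre : Placed
    inner  : ∀ y → Inner y → Placed
    outer  : ∀ v → Outer v → Placed

  pos : Placed → V G
  pos centre      = x
  pos (inner y _) = y
  pos (outer v _) = v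

  Apart : Placed → Placed → Set
  Apart centre      centre       = ⊥
  Apart (inner y _) (inner y′ _) = y ≢ y′
  Apart (outer v _) (outer v′ _) = v ≢ v′
  Apart _           _            = ⊤

  apart⇒≢ : ∀ {p q} → Apart p q → pos p ≢ pos q
  apart⇒≢ {centre}    {inner y xy} _ x≡y  = E⇒≢ G xy x≡y
  apart⇒≢ {centre}    {outer v Nv} _ x≡v  = proj₁ (proj₂ Nv) (sym x≡v)
  apart⇒≢ {inner y xy} {centre}    _ y≡x  = E⇒≢ G xy (sym y≡x)
  apart⇒≢ {inner y xy} {inner _ _} y≢y′   = y≢y′
  apart⇒≢ {inner y xy} {outer v Nv} _ refl = proj₁ (proj₂ (proj₂ Nv)) xy
  apart⇒≢ {outer v Nv} {centre}    _ v≡x  = proj₁ (proj₂ Nv) v≡x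
  apart⇒≢ {outer v Nv} {inner y xy} _ refl = proj₁ (proj₂ (proj₂ Nv)) xy
  apart⇒≢ {outer v Nv} {outer _ _} v≢v′   = v≢v′

  noCycle : ∀ {m} → ¬ ContainsC G (suc m) → (ps : Vec Placed (suc m)) →
            AllPairs Apart ps → Closed G (map pos ps) → ⊥
  noCycle forbidden ps apart closed =
    forbidden (closed⇒ContainsC G (map pos ps) (map⁺ (AllPairs.map apart⇒≢ apart)) closed)

  -- The forbidden cycles used below; each lists only the distinctness facts that neither
  -- the layers nor the cycle's own edges provide.
  heptagon : ∀ {y d s z b w} → Outer d → Outer s → Outer b → Inner y → Inner z → Inner w →
             d ≢ b → s ≢ b → y ≢ z → y ≢ w → z ≢ w →
             E G y d → E G d s → E G s z → E G z b → E G b w → ⊥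
  heptagon {y} {d} {s} {z} {b} {w} Nd Ns Nb xy xz xw d≢b s≢b y≢z y≢w z≢w yd ds sz zb bw =
    noCycle (proj₂ free)
      (centre ∷ inner y xy ∷ outer d Nd ∷ outer s Ns ∷ inner z xz ∷ outer b Nb ∷ inner w xw ∷ [])
      ( (tt ∷ tt ∷ tt ∷ tt ∷ tt ∷ tt ∷ [])
      ∷ (tt ∷ tt ∷ y≢z ∷ tt ∷ y≢w ∷ [])
      ∷ (E⇒≢ G ds ∷ tt ∷ d≢b ∷ tt ∷ [])
      ∷ (tt ∷ s≢b ∷ tt ∷ [])
      ∷ (tt ∷ z≢w ∷ [])
      ∷ (tt ∷ [])
      ∷ [] ∷ [])
      (xy , yd , ds , sz , zb , bw , E-sym G xw)

  hexagon-threeOuter : ∀ {z u w e y} → Outer u → Outer w → Outer e → Inner z → Inner y →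
                       u ≢ e → z ≢ y →
                       E G z u → E G u w → E G w e → E G e y → ⊥
  hexagon-threeOuter {z} {u} {w} {e} {y} Nu Nw Ne xz xy u≢e z≢y zu uw we ey =
    noCycle (proj₁ free)
      (centre ∷ inner z xz ∷ outer u Nu ∷ outer w Nw ∷ outer e Ne ∷ inner y xy ∷ [])
      ( (tt ∷ tt ∷ tt ∷ tt ∷ tt ∷ [])
      ∷ (tt ∷ tt ∷ tt ∷ z≢y ∷ [])
      ∷ (E⇒≢ G uw ∷ u≢e ∷ tt ∷ [])
      ∷ (E⇒≢ G we ∷ tt ∷ [])
      ∷ (tt ∷ [])
      ∷ [] ∷ [])
      (xz , zu , uw , we , ey , E-sym G xy)

  hexagon-threeInner : ∀ {p b q a r} → Outer b → Outer a → Inner p → Inner q → Inner r →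
                       a ≢ b → p ≢ q → p ≢ r → q ≢ r →
                       E G p b → E G b q → E G q a → E G a r → ⊥
  hexagon-threeInner {p} {b} {q} {a} {r} Nb Na xp xq xr a≢b p≢q p≢r q≢r pb bq qa ar =
    noCycle (proj₁ free)
      (centre ∷ inner p xp ∷ outer b Nb ∷ inner q xq ∷ outer a Na ∷ inner r xr ∷ [])
      ( (tt ∷ tt ∷ tt ∷ tt ∷ tt ∷ [])
      ∷ (tt ∷ p≢q ∷ tt ∷ p≢r ∷ [])
      ∷ (tt ∷ ≢-sym a≢b ∷ tt ∷ [])
      ∷ (tt ∷ q≢r ∷ [])
      ∷ (tt ∷ [])
      ∷ [] ∷ [])
      (xp , pb , bq , qa , ar , E-sym G xr)

  hexagon-opposite : ∀ {d s y b a z} → Outer d → Outer s → Outer b → Outer a → Inner y → Inner z →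
                     d ≢ b → d ≢ a → s ≢ b → s ≢ a → y ≢ z →
                     E G d s → E G s y → E G y b → E G b a → E G a z → E G z d → ⊥
  hexagon-opposite {d} {s} {y} {b} {a} {z} Nd Ns Nb Na xy xz d≢b d≢a s≢b s≢a y≢z ds sy yb ba az zd =
    noCycle (proj₁ free)
      (outer d Nd ∷ outer s Ns ∷ inner y xy ∷ outer b Nb ∷ outer a Na ∷ inner z xz ∷ [])
      ( (E⇒≢ G ds ∷ tt ∷ d≢b ∷ d≢a ∷ tt ∷ [])
      ∷ (tt ∷ s≢b ∷ s≢a ∷ tt ∷ [])
      ∷ (tt ∷ tt ∷ y≢z ∷ [])
      ∷ (E⇒≢ G ba ∷ tt ∷ [])
      ∷ (tt ∷ [])
      ∷ [] ∷ [])
      (ds , sy , yb , ba , az , zd)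

  hexagon-near : ∀ {u y v z w t} → Outer u → Outer v → Outer w → Outer t → Inner y → Inner z →
                 u ≢ v → u ≢ w → v ≢ w → v ≢ t → y ≢ z →
                 E G u y → E G y v → E G v z → E G z w → E G w t → E G t u → ⊥
  hexagon-near {u} {y} {v} {z} {w} {t} Nu Nv Nw Nt xy xz u≢v u≢w v≢w v≢t y≢z uy yv vz zw wt tu =
    noCycle (proj₁ free)
      (outer u Nu ∷ inner y xy ∷ outer v Nv ∷ inner z xz ∷ outer w Nw ∷ outer t Nt ∷ [])
      ( (tt ∷ u≢v ∷ tt ∷ u≢w ∷ ≢-sym (E⇒≢ G tu) ∷ [])
      ∷ (tt ∷ y≢z ∷ tt ∷ tt ∷ [])
      ∷ (tt ∷ v≢w ∷ v≢t ∷ [])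
      ∷ (tt ∷ tt ∷ [])
      ∷ (E⇒≢ G wt ∷ [])
      ∷ [] ∷ [])
      (uy , yv , vz , zw , wt , tu)

  -- By induction along the walk: if
  -- the next vertex w misses y, the neighbour e of w given by induction closes the 6-cycle
  -- x z u w e y, where z ∈ N(x) witnesses u ∈ N₂(x).
  shortcut : ∀ {u d y} → Walk G Outer u d → E G d y → ¬ E G u y → Inner y →
             Σ (V G) λ e → Outer e × E G u e × E G e y
  shortcut (here _) dy ¬uy _ = ⊥-elim (¬uy dy)
  shortcut {u} {y = y} (step {w = w} Nu uw rest) dy ¬uy xy with E? G w y
  ... | yes wy = w , walkHead G rest , uw , wy
  ... | no ¬wy with shortcut rest dy ¬wy xy | Nu
  ...   | e , Ne , we , ey | _ , _ , _ , z , _ , xz , zu =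
    ⊥-elim (hexagon-threeOuter Nu (walkHead G rest) Ne xz xy
              (≢-sym (separates (λ v → E G v y) ey ¬uy)) (separates (E G u) (E-sym G zu) ¬uy)
              zu uw we ey)

  Escape : V G → Set
  Escape s = Σ (V G) λ d → Outer d × E G s d × Σ (V G) λ t → Inner t × E G d t × ¬ E G s t

  escape? : ∀ s → Dec (Escape s)
  escape? s = any? (λ d → Outer? d ×-dec E? G s d ×-dec
                         any? (λ t → E? G x t ×-dec E? G d t ×-dec ¬? (E? G s t)))

  -- Without an escape, N(x) ∩ N(s) = N(x) ∩ N(C) for the N₂-component C of s (by the
  -- shortcut lemma), so C is one of the components forming A*.
  trapped⇒InA* : ∀ {s} → Outer s → ¬ Escape s → InA* G x s
  trapped⇒InA* {s} Ns ¬esc with componentOf G Outer Outer? s Ns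
  ... | C , C-comp@(inOuter , _ , connected , _) , s∈C = C , (C-comp , s , s∈C , ⊆-shared , ⊇-shared) , s∈C
    where
      ⊆-shared : ∀ y → Nb G (All G) x y × Nb G (All G) s y → Nb G (All G) x y × NbSet G (All G) (_∈ C) y
      ⊆-shared y ((_ , xy) , (_ , sy)) =
        (tt , xy) , (tt , (λ y∈C → proj₁ (proj₂ (proj₂ (inOuter y y∈C))) xy) , s , s∈C , sy)

      ⊇-shared : ∀ y → Nb G (All G) x y × NbSet G (All G) (_∈ C) y → Nb G (All G) x y × Nb G (All G) s y
      ⊇-shared y ((_ , xy) , (_ , _ , t , t∈C , ty)) with E? G s y
      ... | yes sy = (tt , xy) , (tt , sy)
      ... | no ¬sy with shortcut (connected s t s∈C t∈C) ty ¬sy xy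
      ...   | e , Ne , se , ey = ⊥-elim (¬esc (e , Ne , se , y , xy , ey , ¬sy))

  Unanchored : V G → Set
  Unanchored s = Outer s × ¬ InA* G x s

  escape : ∀ {s} → Unanchored s → Escape s
  escape {s} (Ns , s∉A*) with escape? s
  ... | yes esc  = esc
  ... | no ¬esc = ⊥-elim (s∉A* (trapped⇒InA* Ns ¬esc))

  -- Let s, b ∈ N₂(x) meet at z ∈ N(x), and let b also see w ≠ z in N(x).  An escape (d, t)
  -- of s either goes through b or lands on w: otherwise  x t d s z b w  is a C₇.
  escapeRoute : ∀ {s b z w d t} → Outer s → Outer b → s ≢ b → Inner z → Inner w → z ≢ w →
                E G s z → E G b z → E G b w → Outer d → E G s d → Inner t → E G d t → ¬ E G s t →
                d ≡ b ⊎ t ≡ w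
  escapeRoute {s} {b} {w = w} {d} {t} Ns Nb s≢b xz xw z≢w sz bz bw Nd sd xt dt ¬st with d ≟ b | t ≟ w
  ... | yes d≡b | _       = inj₁ d≡b
  ... | no _    | yes t≡w = inj₂ t≡w
  ... | no d≢b  | no t≢w  =
    ⊥-elim (heptagon Nd Ns Nb xt xz xw d≢b s≢b (≢-sym (separates (E G s) sz ¬st)) t≢w z≢w
              (E-sym G dt) (E-sym G sd) sz (E-sym G bz) bw)

  -- Case 1: adjacent a, b share two x-neighbours.  The escapes of a and of b are forced
  -- through each other, and their targets close the 6-cycle  x p b y₁ a r.
  bothShared : ∀ {a b y₁ y₂} → Unanchored a → Unanchored b → E G a b →
               Inner y₁ → Inner y₂ → y₁ ≢ y₂ →
               E G a y₁ → E G a y₂ → E G b y₁ → E G b y₂ → ⊥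
  bothShared {a} {b} Ua@(Na , _) Ub@(Nb , _) ab xy₁ xy₂ y₁≢y₂ ay₁ ay₂ by₁ by₂
    with escape Ua | escape Ub
  ... | d , Nd , ad , p , xp , dp , ¬ap | e , Ne , be , r , xr , er , ¬br
    with escapeRoute Na Nb (E⇒≢ G ab) xy₁ xy₂ y₁≢y₂ ay₁ by₁ by₂ Nd ad xp dp ¬ap
       | escapeRoute Nb Na (E⇒≢ G (E-sym G ab)) xy₁ xy₂ y₁≢y₂ by₁ ay₁ ay₂ Ne be xr er ¬br
  ... | inj₂ refl | _         = ¬ap ay₂
  ... | inj₁ _    | inj₂ refl = ¬br by₂
  ... | inj₁ refl | inj₁ refl =
    hexagon-threeInner Nb Na xp xy₁ xr (E⇒≢ G ab)
      (≢-sym (separates (E G a) ay₁ ¬ap)) (separates (E G b) dp ¬br) (separates (E G b) by₁ ¬br)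
      (E-sym G dp) by₁ (E-sym G ay₁) er

  -- Then s is adjacent to neither a nor b (7-cycles), so s's escape must
  -- land on z, which closes a 6-cycle avoiding x.
  oneShared : ∀ {a b z p q s} → Outer a → Outer b → E G a b → Inner z → Inner p → Inner q →
              z ≢ p → z ≢ q → p ≢ q →
              E G a z → E G a p → E G b z → E G b q → Unanchored s → E G s q → s ≢ a → s ≢ b → ⊥
  oneShared {a} {b} {s = s} Na Nb ab xz xp xq z≢p z≢q p≢q az ap bz bq Us@(Ns , _) sq s≢a s≢b =
    viaEscape (escape Us)
    where
      ¬sa : ¬ E G s a
      ¬sa sa = heptagon Na Ns Nb xp xq xz (E⇒≢ G ab) s≢b p≢q (≢-sym z≢p) (≢-sym z≢q)
                 (E-sym G ap) (E-sym G sa) sq (E-sym G bq) bz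

      ¬sb : ¬ E G s b
      ¬sb sb = heptagon Ns Nb Na xq xz xp s≢a (≢-sym (E⇒≢ G ab)) (≢-sym z≢q) (≢-sym p≢q) z≢p
                 (E-sym G sq) sb bz (E-sym G az) ap

      viaEscape : Escape s → ⊥
      viaEscape (d , Nd , sd , t , xt , dt , ¬st)
        with escapeRoute Ns Nb s≢b xq xz (≢-sym z≢q) sq bq bz Nd sd xt dt ¬st
      ... | inj₁ refl = ¬sb sd
      ... | inj₂ refl =
        hexagon-opposite Nd Ns Nb Na xq xt (separates (E G s) sd ¬sb) (separates (E G s) sd ¬sa) s≢b s≢a
          (≢-sym z≢q) (E-sym G sd) sq (E-sym G bq) (E-sym G ab) az (E-sym G dt)

  -- Then s₃ ≠ s₄, neither sees b, the escapes of s₃ and s₄ land on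
  -- y₄ and y₃ respectively, and these close a 6-cycle avoiding x.
  noneShared : ∀ {a b y₁ y₃ y₄ s₃ s₄} → Outer a → Outer b → E G a b →
               Inner y₁ → Inner y₃ → Inner y₄ → y₃ ≢ y₄ →
               E G a y₁ → E G b y₃ → E G b y₄ → ¬ E G a y₃ → ¬ E G a y₄ →
               Unanchored s₃ → Unanchored s₄ → E G s₃ y₃ → E G s₄ y₄ → s₃ ≢ b → s₄ ≢ b → ¬ E G s₃ s₄ → ⊥
  noneShared {a} {b} {y₃ = y₃} {s₃ = s₃} {s₄} Na Nb ab xy₁ xy₃ xy₄ y₃≢y₄ ay₁ by₃ by₄ ¬ay₃ ¬ay₄
             U₃@(N₃ , _) U₄@(N₄ , _) s₃y₃ s₄y₄ s₃≢b s₄≢b ¬s₃s₄ =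
    viaEscapes (escape U₃) (escape U₄)
    where
      ¬toB : ∀ {s y} → Outer s → Inner y → E G s y → ¬ E G a y → ¬ E G s b
      ¬toB {y = y} Ns xy sy ¬ay sb =
        hexagon-threeOuter Na Nb Ns xy₁ xy (≢-sym (separates (λ v → E G v y) sy ¬ay)) (separates (E G a) ay₁ ¬ay)
          (E-sym G ay₁) ab (E-sym G sb) sy

      s₃≢s₄ : s₃ ≢ s₄
      s₃≢s₄ refl =
        heptagon Na Nb N₃ xy₁ xy₄ xy₃ (≢-sym (separates (λ v → E G v y₃) s₃y₃ ¬ay₃)) (≢-sym s₃≢b)
          (separates (E G a) ay₁ ¬ay₄) (separates (E G a) ay₁ ¬ay₃) (≢-sym y₃≢y₄)
          (E-sym G ay₁) ab by₄ (E-sym G s₄y₄) s₃y₃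

      ¬s₄s₃ : ¬ E G s₄ s₃
      ¬s₄s₃ s₄s₃ = ¬s₃s₄ (E-sym G s₄s₃)

      viaEscapes : Escape s₃ → Escape s₄ → ⊥
      viaEscapes (d , Nd , s₃d , t , xt , dt , ¬s₃t) (e , Ne , s₄e , r , xr , er , ¬s₄r)
        with escapeRoute N₃ Nb s₃≢b xy₃ xy₄ y₃≢y₄ s₃y₃ by₃ by₄ Nd s₃d xt dt ¬s₃t
           | escapeRoute N₄ Nb s₄≢b xy₄ xy₃ (≢-sym y₃≢y₄) s₄y₄ by₄ by₃ Ne s₄e xr er ¬s₄r
      ... | inj₁ refl | _         = ¬toB N₃ xy₃ s₃y₃ ¬ay₃ s₃d
      ... | inj₂ _    | inj₁ refl = ¬toB N₄ xy₄ s₄y₄ ¬ay₄ s₄e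
      ... | inj₂ refl | inj₂ refl =
        hexagon-opposite N₃ Nd N₄ Ne xy₄ xy₃ s₃≢s₄ (≢-sym (separates (E G s₄) s₄e ¬s₄s₃))
          (separates (E G s₃) s₃d ¬s₃s₄) (≢-sym (separates (E G s₄) s₄e ¬s₄d)) (≢-sym y₃≢y₄)
          s₃d dt (E-sym G s₄y₄) s₄e er (E-sym G s₃y₃)
        where
          ¬s₄d : ¬ E G s₄ d
          ¬s₄d s₄d =
            hexagon-near N₄ Nb N₃ Nd xy₄ xy₃ s₄≢b (≢-sym s₃≢s₄) (≢-sym s₃≢b)
              (≢-sym (separates (E G s₃) s₃d (¬toB N₃ xy₃ s₃y₃ ¬ay₃))) (≢-sym y₃≢y₄)
              s₄y₄ (E-sym G by₄) by₃ (E-sym G s₃y₃) s₃d (E-sym G s₄d)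

  -- From here on neighbourhoods are taken in H_x, as in the corollary.
  H : V G → Set
  H = Hx G x

  Shared : V G → V G → Set
  Shared v y = Nb G H v y × Nb G H x y

  unanchored : ∀ {v} → N₂ G H x v → Unanchored v
  unanchored ((_ , v∉N[A*]) , v≢x , ¬xv , w , _ , xw , wv) =
    (tt , v≢x , ¬xv , w , tt , xw , wv) , (λ v∈A* → v∉N[A*] (tt , inj₁ v∈A*))

  module _ (S : Subset (Graph.n G)) (S⊆N₂ : ∀ v → v ∈ S → N₂ G H x v)
           (independent : ∀ u v → u ∈ S → v ∈ S → ¬ E G u v)
           (dominating : Dominates G H S (Nb G H x)) where

    dominator : ∀ {y} → H y → Inner y → Σ (V G) λ s → s ∈ S × E G s y
    dominator {y} Hy xy with dominating y (Hy , xy)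
    ... | _ , inj₁ y∈S = ⊥-elim (proj₁ (proj₂ (proj₂ (S⊆N₂ y y∈S))) xy)
    ... | _ , inj₂ dominated = dominated

    -- If b ∉ S, none of the three ways N(a) ∩ N(x) and N(b) ∩ N(x) can overlap is possible;
    -- in cases 2 and 3 the escaping vertices are the S-dominators of b's private neighbours.
    -- (In the patterns, P = Shared a and Q = Shared b.)
    excluded : ∀ {a b} → N₂ G H x a → N₂ G H x b → E G a b → b ∉ S → ¬ Overlap G (Shared a) (Shared b)
    excluded Na Nb ab b∉S
             (both y₁≢y₂ ((_ , ay₁) , (_ , xy₁)) ((_ , ay₂) , (_ , xy₂)) ((_ , by₁) , _) ((_ , by₂) , _)) =
      bothShared (unanchored Na) (unanchored Nb) ab xy₁ xy₂ y₁≢y₂ ay₁ ay₂ by₁ by₂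
    excluded {a} {b} Na Nb ab b∉S
             (one Pz@((_ , az) , (_ , xz)) Qz@((_ , bz) , _) ((_ , ap) , (_ , xp)) ¬Qp
                  Qq@((Hq , bq) , (_ , xq)) ¬Pq)
      with dominator Hq xq
    ... | s , s∈S , sq =
      oneShared (proj₁ (unanchored Na)) (proj₁ (unanchored Nb)) ab xz xp xq
        (separates (Shared b) Qz ¬Qp) (separates (Shared a) Pz ¬Pq) (≢-sym (separates (Shared b) Qq ¬Qp))
        az ap bz bq (unanchored (S⊆N₂ s s∈S)) sq
        (λ { refl → ¬Pq ((Hq , sq) , (Hq , xq)) }) (separates (_∈ S) s∈S b∉S)
    excluded {a} {b} Na Nb ab b∉S
             (none ((_ , ay) , (_ , xy)) q₁≢q₂ Q₁@((H₁ , bq₁) , (_ , xq₁)) Q₂@((H₂ , bq₂) , (_ , xq₂)) disjoint)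
      with dominator H₁ xq₁ | dominator H₂ xq₂
    ... | s₁ , s₁∈S , s₁q₁ | s₂ , s₂∈S , s₂q₂ =
      noneShared (proj₁ (unanchored Na)) (proj₁ (unanchored Nb)) ab xy xq₁ xq₂ q₁≢q₂ ay bq₁ bq₂ (¬a Q₁) (¬a Q₂)
        (unanchored (S⊆N₂ s₁ s₁∈S)) (unanchored (S⊆N₂ s₂ s₂∈S)) s₁q₁ s₂q₂
        (separates (_∈ S) s₁∈S b∉S) (separates (_∈ S) s₂∈S b∉S) (independent s₁ s₂ s₁∈S s₂∈S)
      where
        ¬a : ∀ {q} → Shared b q → ¬ E G a q
        ¬a Qq@((Hq , _) , (_ , xq)) aq = disjoint Qq ((Hq , aq) , (Hq , xq))

    adjacentPairFails : ∀ {a b} → N₂ G H x a → N₂ G H x b → E G a b →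
                        HasSize G (Shared a) 2 → HasSize G (Shared b) 2 → ⊥
    adjacentPairFails {a} {b} Na Nb ab sizeA sizeB with b ∈? S | a ∈? S
    ... | no b∉S | _       = excluded Na Nb ab b∉S (overlapOf G (pairOf G sizeA) (pairOf G sizeB))
    ... | yes b∈S | yes a∈S = independent a b a∈S b∈S ab
    ... | yes _   | no a∉S  = excluded Nb Na (E-sym G ab) a∉S (overlapOf G (pairOf G sizeB) (pairOf G sizeA))

corollary4 :
    (G : Graph) → C6C7Free G →
    (x : V G) → (A : Subset (Graph.n G)) →
    Component G (N₂ G (Hx G x) x) A →
    (a b : V G) → a ∈ A → b ∈ A → E G a b →
    HasSize G (λ y → Nb G (Hx G x) a y × Nb G (Hx G x) x y) 2 →
    HasSize G (λ y → Nb G (Hx G x) b y × Nb G (Hx G x) x y) 2 →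
    ¬ (Σ (Subset (Graph.n G)) λ S →
         (∀ v → v ∈ S → N₂ G (Hx G x) x v)
         × Independent G (Hx G x) S
         × Dominates G (Hx G x) S (Nb G (Hx G x) x))
corollary4 G free x A (inA , _) a b a∈A b∈A ab sizeA sizeB (S , S⊆N₂ , (_ , independent) , dominating) =
  Around.adjacentPairFails G free x S S⊆N₂ independent dominating (inA a a∈A) (inA b b∈A) ab sizeA sizeB
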